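{- Let $T$ be a tree with at least $2$ nodes and let $k$ be a positive integer. Let $CT$ be the graph obtained from $T$ by associating with each vertex of $T$ a clique of some size $k' \geq k$ (the size may differ between vertices; cliques are vertex-disjoint) and making all vertices of the cliques associated with adjacent vertices of $T$ mutually adjacent. Let $W,B$ be a partition of $V(CT)$ with $|W| \geq k$ and $|B| \geq k$. Then $CT$ has a matching of size $k$ consisting of edges each having one end in $W$ and one end in $B$.
   Context: A matching is a set of pairwise vertex-disjoint edges. -}

module Defs where

open import Level using (Level; _⊔_) renaming (suc to lsuc)
open import Data.Nat using (ℕ; _≤_)
open import Data.Fin using (Fin)
open import Data.Bool using (Bool; true; false)
open import Data.List using (List; []; _∷_; _++_; [_])
open import Data.List.Relation.Unary.Linked using (Linked)
open import Data.List.Relation.Unary.Unique.Propositional using (Unique)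
open import Data.Product using (Σ; _×_; _,_; proj₁; proj₂; ∃-syntax)
open import Data.Sum using (_⊎_)
open import Data.Empty using (⊥)
open import Relation.Nullary using (¬_)
open import Relation.Binary.PropositionalEquality using (_≡_; _≢_)
open import Function.Definitions using (Injective)

record SimpleGraph (V : Set) : Set₁ where
  field
    Adj   : V → V → Set
    sym   : ∀ {u v} → Adj u v → Adj v u
    irrefl : ∀ {v} → ¬ Adj v v

open SimpleGraph public

data Walk {V : Set} (G : SimpleGraph V) : V → V → Set where
  nil  : ∀ {v} → Walk G v v
  cons : ∀ {u v w} → Adj G u v → Walk G v w → Walk G u w

Connected : {V : Set} → SimpleGraph V → Set
Connected G = ∀ u v → Walk G u v

HasCycle : {V : Set} → SimpleGraph V → Set
HasCycle {V} G =
  Σ V λ x → Σ V λ y → Σ V λ z → Σ (List V) λ zs →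
    Unique (x ∷ y ∷ z ∷ zs) × Linked (Adj G) ((x ∷ y ∷ z ∷ zs) ++ [ x ])

Acyclic : {V : Set} → SimpleGraph V → Set
Acyclic G = ¬ HasCycle G

IsTree : {V : Set} → SimpleGraph V → Set
IsTree G = Connected G × Acyclic G

-- The graph CT: vertex v of T is replaced by a clique of size (size v);
-- two clique vertices are adjacent iff they are distinct vertices of the same
-- clique, or they lie in cliques of adjacent vertices of T.
CTVertex : {n : ℕ} → (Fin n → ℕ) → Set
CTVertex {n} size = Σ (Fin n) λ v → Fin (size v)

CTAdj : {n : ℕ} (T : SimpleGraph (Fin n)) (size : Fin n → ℕ) →
        CTVertex size → CTVertex size → Set
CTAdj T size p q = (proj₁ p ≡ proj₁ q × p ≢ q) ⊎ Adj T (proj₁ p) (proj₁ q)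

AtLeast : {V : Set} → (V → Set) → ℕ → Set
AtLeast {V} S k = Σ (Fin k → Σ V S) λ f → Injective _≡_ _≡_ (λ i → proj₁ (f i))

-- A matching of size k w.r.t. adjacency Adj, in which every edge has one end in
-- W (colour true) and one end in B (colour false): k edges (w i , b i),
-- each an edge of the graph, pairwise vertex-disjoint.
WBMatching : {V : Set} → (V → V → Set) → (V → Bool) → ℕ → Set
WBMatching {V} A col k =
  Σ (Fin k → V) λ w → Σ (Fin k → V) λ b →
    (∀ i → A (w i) (b i)) ×
    (∀ i → col (w i) ≡ true) × (∀ i → col (b i) ≡ false) ×
    (∀ i j → i ≢ j →
       w i ≢ w j × w i ≢ b j × b i ≢ b j × b i ≢ w j)

module Submission where

-- Every edge of the matching we build joins two cliques
-- attached to ADJACENT vertices of T; such an edge meets each clique in at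
-- most one vertex.  We build the matching greedily, one edge at a time.
-- Suppose j < k edges are chosen.  By pigeonhole,
--   * some white vertex x and some black vertex y are still free
--     (each chosen edge has one white and one black end, and |W|,|B| ≥ k > j),
--   * every clique still has a free vertex (its size is ≥ k > j).
-- Walk in T from the clique of x towards the clique of y, picking a free
-- vertex z in each clique on the way: the first black z gives a new edge from
-- the previous white vertex, and if all are white, the last one is joined to y
-- (if x and y lie in the same clique, walk to a neighbour and back first).

open import Defs
open import Data.Nat using (ℕ; _≤_; _<_; zero; suc; s≤s; z≤n)
open import Data.Nat.Properties using (<⇒≤; ≤-refl; <-≤-trans)
open import Data.Fin using (Fin; zero; suc)
open import Data.Fin.Properties using (pigeonhole; any?; all?; ¬∀⟶∃¬; <⇒≢)
  renaming (_≟_ to _≟ᶠ_)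
open import Data.Product.Properties using (≡-dec)
open import Data.Bool using (Bool; true; false)
open import Data.Product using (Σ; ∃; _×_; _,_; proj₁; proj₂)
open import Data.Sum using (_⊎_; inj₁; inj₂)
open import Relation.Nullary using (¬_; Dec; yes; no; contradiction)
open import Relation.Nullary.Decidable using (¬?; _⊎-dec_; decidable-stable)
open import Relation.Binary.Definitions using (DecidableEquality)
open import Relation.Binary.PropositionalEquality
  using (_≡_; _≢_; refl; trans; cong; subst) renaming (sym to ≡-sym)
open import Function.Definitions using (Injective)

module Endpoints {V : Set} where

  Endpoint : ∀ {j} → (Fin j → V) → (Fin j → V) → Fin j → V → Set
  Endpoint w b p x = x ≡ w p ⊎ x ≡ b p

  Avoids : ∀ {j} → (Fin j → V) → (Fin j → V) → V → Set
  Avoids w b x = ∀ p → ¬ Endpoint w b p x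

  separated-ends : ∀ {X : Set} {j} (f : V → X) (w b : Fin j → V) {p x y} →
                   f (w p) ≢ f (b p) → Endpoint w b p x → Endpoint w b p y →
                   f x ≡ f y → x ≡ y
  separated-ends f w b sep (inj₁ refl) (inj₁ refl) _  = refl
  separated-ends f w b sep (inj₂ refl) (inj₂ refl) _  = refl
  separated-ends f w b sep (inj₁ refl) (inj₂ refl) fx = contradiction fx sep
  separated-ends f w b sep (inj₂ refl) (inj₁ refl) fx = contradiction (≡-sym fx) sep

  module _ (_≟_ : DecidableEquality V) where

    endpoint? : ∀ {j} (w b : Fin j → V) p x → Dec (Endpoint w b p x)
    endpoint? w b p x = (x ≟ w p) ⊎-dec (x ≟ b p)

    avoids? : ∀ {j} (w b : Fin j → V) x → Dec (Avoids w b x)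
    avoids? w b x = all? (λ p → ¬? (endpoint? w b p x))

    endpoint-of : ∀ {j} (w b : Fin j → V) x → ¬ Avoids w b x → ∃ λ p → Endpoint w b p x
    endpoint-of {j} w b x ¬avoids with ¬∀⟶∃¬ j _ (λ p → ¬? (endpoint? w b p x)) ¬avoids
    ... | p , ¬¬end = p , decidable-stable (endpoint? w b p x) ¬¬end

    -- Pigeonhole: m > j distinct candidates in one fibre of f, and j edges
    -- whose ends lie in different fibres; then some candidate avoids all edges,
    -- because each edge can absorb at most one candidate.
    free-candidate : ∀ {X : Set} {j m} (f : V → X) (w b : Fin j → V) →
                     (∀ p → f (w p) ≢ f (b p)) → j < m →
                     (g : Fin m → V) → Injective _≡_ _≡_ g →
                     (∀ i i' → f (g i) ≡ f (g i')) →
                     ∃ λ i → Avoids w b (g i)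
    free-candidate {j = j} {m} f w b sep j<m g g-inj same-fibre
      with any? (λ i → avoids? w b (g i))
    ... | yes found = found
    ... | no none = contradiction i≡i' (<⇒≢ i<i')
      where
        edge-at : ∀ i → ∃ λ p → Endpoint w b p (g i)
        edge-at i = endpoint-of w b (g i) (λ avoids → none (i , avoids))

        collision = pigeonhole j<m (λ i → proj₁ (edge-at i))
        i    = proj₁ collision
        i'   = proj₁ (proj₂ collision)
        i<i' = proj₁ (proj₂ (proj₂ collision))
        p    = proj₁ (edge-at i)

        i'-on-p : Endpoint w b p (g i')
        i'-on-p = subst (λ q → Endpoint w b q (g i')) (≡-sym (proj₂ (proj₂ (proj₂ collision))))
                        (proj₂ (edge-at i'))

        -- g i and g i' are ends of the same edge p and in the same fibre.
        i≡i' : i ≡ i'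
        i≡i' = g-inj (separated-ends f w b (sep p) (proj₂ (edge-at i)) i'-on-p (same-fibre i i'))

open Endpoints

WBMatching-mono : ∀ {V : Set} {A A' : V → V → Set} {col : V → Bool} {k} →
                  (∀ x y → A x y → A' x y) → WBMatching A col k → WBMatching A' col k
WBMatching-mono A⊆A' (w , b , adj , cw , cb , disj) =
  w , b , (λ i → A⊆A' (w i) (b i) (adj i)) , cw , cb , disj

module Matchings {V : Set} (A : V → V → Set) (col : V → Bool) where

  whites blacks : ∀ {j} → WBMatching A col j → Fin j → V
  whites M = proj₁ M
  blacks M = proj₁ (proj₂ M)

  edges : ∀ {j} (M : WBMatching A col j) p → A (whites M p) (blacks M p)
  edges M = proj₁ (proj₂ (proj₂ M))

  Free : ∀ {j} → WBMatching A col j → V → Set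
  Free M = Avoids (whites M) (blacks M)

  colours-differ : ∀ {j} (M : WBMatching A col j) p → col (whites M p) ≢ col (blacks M p)
  colours-differ (_ , _ , _ , cw , cb , _) p eq with trans (≡-sym (cw p)) (trans eq (cb p))
  ... | ()

  Augmentation : ∀ {j} → WBMatching A col j → Set
  Augmentation M = Σ V λ x → Σ V λ y →
    Free M x × Free M y × col x ≡ true × col y ≡ false × A x y

  empty : WBMatching A col 0
  empty = (λ ()) , (λ ()) , (λ ()) , (λ ()) , (λ ()) , (λ ())

  augment : ∀ {j} (M : WBMatching A col j) → Augmentation M → WBMatching A col (suc j)
  augment {j} (w , b , adj , cw , cb , disj) (x , y , fx , fy , cx , cy , xy) =
    w' , b' , adj' , cw' , cb' , disj'
    where
      w' b' : Fin (suc j) → V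
      w' zero = x
      w' (suc i) = w i
      b' zero = y
      b' (suc i) = b i
      adj' : ∀ i → A (w' i) (b' i)
      adj' zero = xy
      adj' (suc i) = adj i
      cw' : ∀ i → col (w' i) ≡ true
      cw' zero = cx
      cw' (suc i) = cw i
      cb' : ∀ i → col (b' i) ≡ false
      cb' zero = cy
      cb' (suc i) = cb i
      disj' : ∀ i i' → i ≢ i' → w' i ≢ w' i' × w' i ≢ b' i' × b' i ≢ b' i' × b' i ≢ w' i'
      disj' zero zero ne = contradiction refl ne
      disj' zero (suc q) _ =
        (λ e → fx q (inj₁ e)) , (λ e → fx q (inj₂ e)) , (λ e → fy q (inj₂ e)) , (λ e → fy q (inj₁ e))
      disj' (suc p) zero _ =
        (λ e → fx p (inj₁ (≡-sym e))) , (λ e → fy p (inj₁ (≡-sym e))) ,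
        (λ e → fy p (inj₂ (≡-sym e))) , (λ e → fx p (inj₂ (≡-sym e)))
      disj' (suc p) (suc q) ne = disj p q (λ e → ne (cong suc e))

  free-of-colour : DecidableEquality V → ∀ {j k} (M : WBMatching A col j) → j < k →
                   (c : Bool) → AtLeast (λ x → col x ≡ c) k → ∃ λ x → col x ≡ c × Free M x
  free-of-colour _≟_ M j<k c (members , members-inj) with
    free-candidate _≟_ col (whites M) (blacks M) (colours-differ M) j<k
      (λ i → proj₁ (members i)) members-inj
      (λ i i' → trans (proj₂ (members i)) (≡-sym (proj₂ (members i'))))
  ... | i , free = proj₁ (members i) , proj₂ (members i) , free

module CliqueTree {n : ℕ} (T : SimpleGraph (Fin n)) (size : Fin n → ℕ)
                  (col : CTVertex size → Bool) where

  V : Set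
  V = CTVertex size

  node : V → Fin n
  node = proj₁

  _≟_ : DecidableEquality V
  _≟_ = ≡-dec _≟ᶠ_ _≟ᶠ_

  Across : V → V → Set
  Across x y = Adj T (node x) (node y)

  open Matchings Across col public

  across⊆CTAdj : ∀ x y → Across x y → CTAdj T size x y
  across⊆CTAdj _ _ = inj₂

  index-injective : ∀ {v} {a c : Fin (size v)} → _≡_ {A = V} (v , a) (v , c) → a ≡ c
  index-injective refl = refl

  across-separates : ∀ {j} (M : WBMatching Across col j) p →
                     node (whites M p) ≢ node (blacks M p)
  across-separates M p same = irrefl T (subst (λ u → Adj T u _) same (edges M p))

  free-in-clique : ∀ {j} (M : WBMatching Across col j) v → j < size v →
                   ∃ λ z → node z ≡ v × Free M z
  free-in-clique M v j<size with
    free-candidate _≟_ node (whites M) (blacks M) (across-separates M) j<size (λ i → v , i) index-injective (λ _ _ → refl)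
  ... | i , free = (v , i) , refl , free

  module Walking {j} (M : WBMatching Across col j)
                 (fresh : ∀ v → ∃ λ z → node z ≡ v × Free M z) where

    along-walk : ∀ x y {u} → Free M x → Free M y → col x ≡ true → col y ≡ false →
                 Adj T (node x) u → Walk T u (node y) → Augmentation M
    along-walk x y fx fy cx cy xu nil = x , y , fx , fy , cx , cy , xu
    along-walk x y fx fy cx cy xu (cons uv rest) with fresh _
    ... | z , refl , fz with col z in cz
    ... | true  = along-walk z y fz fy cz cy uv rest
    ... | false = x , z , fx , fz , cx , cz , xu

    augmenting-edge : Connected T → (∀ v → ∃ (Adj T v)) →
                      ∀ x y → Free M x → Free M y → col x ≡ true → col y ≡ false →
                      Augmentation M
    augmenting-edge conn neighbour x y fx fy cx cy with conn (node x) (node y)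
    ... | cons xu rest = along-walk x y fx fy cx cy xu rest
    ... | nil with neighbour (node x)
    ...   | d , xd = along-walk x y fx fy cx cy xd (cons (SimpleGraph.sym T xd) nil)

  module Greedy (conn : Connected T) (neighbour : ∀ v → ∃ (Adj T v)) {k : ℕ}
                (big : ∀ v → k ≤ size v)
                (W : AtLeast (λ x → col x ≡ true) k) (B : AtLeast (λ x → col x ≡ false) k) where

    extend : ∀ {j} (M : WBMatching Across col j) → j < k → WBMatching Across col (suc j)
    extend M j<k with free-of-colour _≟_ M j<k true W | free-of-colour _≟_ M j<k false B
    ... | x , cx , fx | y , cy , fy = augment M (augmenting-edge conn neighbour x y fx fy cx cy)
      where open Walking M (λ v → free-in-clique M v (<-≤-trans j<k (big v)))

    grow : ∀ j → j ≤ k → WBMatching Across col j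
    grow zero    _   = empty
    grow (suc j) j<k = extend (grow j (<⇒≤ j<k)) j<k

-- In a connected graph with at least two vertices every vertex has a neighbour:
-- the walk to some other vertex starts with an edge.
has-neighbour : ∀ {m} (G : SimpleGraph (Fin (suc (suc m)))) → Connected G →
                ∀ v → ∃ (Adj G v)
has-neighbour G conn v = first-step (proj₂ (other-of v)) (conn v (proj₁ (other-of v)))
  where
    other-of : ∀ {m} (v : Fin (suc (suc m))) → ∃ λ u → v ≢ u
    other-of zero    = suc zero , λ ()
    other-of (suc _) = zero , λ ()

    first-step : ∀ {u} → v ≢ u → Walk G v u → ∃ (Adj G v)
    first-step v≢v nil = contradiction refl v≢v
    first-step _ (cons vw _) = _ , vw

lemma4 : (n : ℕ) → 2 ≤ n → (T : SimpleGraph (Fin n)) → IsTree T →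
         (k : ℕ) → 1 ≤ k →
         (size : Fin n → ℕ) → (∀ v → k ≤ size v) →
         (col : CTVertex size → Bool) →
         AtLeast (λ x → col x ≡ true) k →
         AtLeast (λ x → col x ≡ false) k →
         WBMatching (CTAdj T size) col k
lemma4 (suc (suc m)) (s≤s (s≤s z≤n)) T (conn , _) k _ size big col W B =
  WBMatching-mono {col = col} across⊆CTAdj (grow k ≤-refl)
  where open CliqueTree T size col
        open Greedy conn (has-neighbour T conn) big W B
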